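{- Let $S$ be a finite symmetric N-step set, i.e. $-s:=\{ -a: a\in s\}\in S$ for every $s\in S$, with weights $p_s$. Then the generating function $D^+(0,1;t)$ of N-excursions on $S$ is symmetric in $p_s$ and $p_{ -s}$ for all $s\in S$: it is unchanged by the substitution exchanging $p_s$ and $p_{ -s}$ for every $s\in S$.
   Context: An N-step is a non-empty finite set of integers. For a finite set $S$ of N-steps with weights $p_s$, an N-walk is a finite sequence $(s_1,\dots,s_n)$ of elements of $S$, starting at $0$, with weight $\prod_i p_{s_i}$. A classical walk $(v_1,\dots,v_n)$ with positions $\omega_k=\sum_{i\le k}v_i$ is compatible if $v_i\in s_i$ for all $i$; it is an excursion if all $\omega_k\ge0$ and $\omega_n=0$. An N-excursion is an N-walk compatible with at least one excursion. $D^+(0,1;t)=\sum_w(\prod_ip_{s_i})t^{|w|}$ over N-excursions $w$. -}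

module Defs where

open import Level using (Level)
open import Data.Nat using (ℕ; zero; suc)
open import Data.Fin using (Fin)
open import Data.Integer using (ℤ; _+_; _≤_; 0ℤ)
open import Data.Integer.Properties using (_≟_; _≤?_)
open import Data.List using (List; []; _∷_; concatMap; map; filter)
open import Data.List.Membership.Propositional using (_∈_; find; lose)
open import Data.List.Relation.Unary.Any using (Any; any?)
open import Data.Vec using (Vec; []; _∷_)
open import Data.Product using (Σ; ∃; _×_; _,_)
open import Relation.Nullary using (Dec; yes; no)
open import Relation.Nullary.Decidable using (map′; _×-dec_)
open import Relation.Binary.PropositionalEquality using (_≡_; refl)
open import Algebra.Bundles using (CommutativeSemiring)

-- An N-step is a non-empty finite set of integers; we represent it by a
-- list of integers (order/duplicates irrelevant: only membership matters),
-- non-emptiness being imposed as a hypothesis.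
NStep : Set
NStep = List ℤ

SameSet : NStep → NStep → Set
SameSet a b = (∀ x → x ∈ a → x ∈ b) × (∀ x → x ∈ b → x ∈ a)

-- An N-walk of length n over S = {steps i | i : Fin k}: a sequence of steps.
NWalk : ℕ → ℕ → Set
NWalk k n = Vec (Fin k) n

data Compatible {k : ℕ} (steps : Fin k → NStep) :
       {n : ℕ} → NWalk k n → Vec ℤ n → Set where
  []  : Compatible steps [] []
  _∷_ : ∀ {n i a} {w : NWalk k n} {v : Vec ℤ n} →
        a ∈ steps i → Compatible steps w v → Compatible steps (i ∷ w) (a ∷ v)

ExcursionFrom : {n : ℕ} → ℤ → Vec ℤ n → Set
ExcursionFrom h []      = h ≡ 0ℤ
ExcursionFrom h (a ∷ v) = (0ℤ ≤ h + a) × ExcursionFrom (h + a) v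

Excursion : {n : ℕ} → Vec ℤ n → Set
Excursion v = ExcursionFrom 0ℤ v

IsNExcursion : {k : ℕ} → (Fin k → NStep) → {n : ℕ} → NWalk k n → Set
IsNExcursion steps {n} w = Σ (Vec ℤ n) λ v → Compatible steps w v × Excursion v

private
  NExcFrom : {k : ℕ} → (Fin k → NStep) → {n : ℕ} → ℤ → NWalk k n → Set
  NExcFrom steps {n} h w = Σ (Vec ℤ n) λ v → Compatible steps w v × ExcursionFrom h v

  decFrom : {k : ℕ} (steps : Fin k → NStep) {n : ℕ} (h : ℤ) (w : NWalk k n) →
            Dec (NExcFrom steps h w)
  decFrom steps h [] = map′ (λ e → [] , [] , e) (λ { ([] , [] , e) → e }) (h ≟ 0ℤ)
  decFrom steps h (i ∷ w) =
    map′ to from (any? (λ a → (0ℤ ≤? h + a) ×-dec decFrom steps (h + a) w) (steps i))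
    where
    to : Any (λ a → (0ℤ ≤ h + a) × NExcFrom steps (h + a) w) (steps i) →
         NExcFrom steps h (i ∷ w)
    to p with find p
    ... | a , a∈ , (le , v , c , e) = a ∷ v , a∈ ∷ c , le , e
    from : NExcFrom steps h (i ∷ w) →
           Any (λ a → (0ℤ ≤ h + a) × NExcFrom steps (h + a) w) (steps i)
    from (a ∷ v , a∈ ∷ c , le , e) = lose a∈ (le , v , c , e)

isNExcursion? : {k : ℕ} (steps : Fin k → NStep) {n : ℕ} (w : NWalk k n) →
                Dec (IsNExcursion steps w)
isNExcursion? steps w = decFrom steps 0ℤ w

allNWalks : (k n : ℕ) → List (NWalk k n)
allNWalks k zero    = [] ∷ []
allNWalks k (suc n) = concatMap (λ i → map (i ∷_) (allNWalks k n)) (Data.List.allFin k)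
  where import Data.List

nExcursions : {k : ℕ} (steps : Fin k → NStep) (n : ℕ) → List (NWalk k n)
nExcursions {k} steps n = filter (isNExcursion? steps) (allNWalks k n)

module _ {c ℓ : Level} (R : CommutativeSemiring c ℓ) where
  open CommutativeSemiring R using (Carrier; 0#; 1#) renaming (_+_ to _⊕_; _*_ to _⊛_)

  weight : {k n : ℕ} → (Fin k → Carrier) → NWalk k n → Carrier
  weight p []      = 1#
  weight p (i ∷ w) = p i ⊛ weight p w

  sumR : List Carrier → Carrier
  sumR []       = 0#
  sumR (x ∷ xs) = x ⊕ sumR xs

  -- coefficient of tⁿ in D⁺(0,1;t) = Σ_{N-excursions w} (∏ p_{sᵢ}) t^{|w|}
  D⁺-coeff : {k : ℕ} → (Fin k → NStep) → (Fin k → Carrier) → ℕ → Carrier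
  D⁺-coeff steps p n = sumR (map (weight p) (nExcursions steps n))

-- Reading an N-walk backwards and replacing every step s by -s is an
-- involution on N-walks of length n (s ↦ -s is an involution on S because
-- the steps are distinct sets).  It maps compatible classical walks to
-- compatible classical walks, and it maps excursions to excursions, since
-- the time reversal of a path from 0 to 0 staying ≥ 0 is again such a
-- path.  Hence it permutes the N-excursions of length n, and it turns the
-- weight ∏ p_{sᵢ} into ∏ p_{-sᵢ}; summing over this bijection gives the
-- identity coefficient by coefficient.
{-# OPTIONS --safe #-}
module Submission where

open import Defs
open import Level using (Level)
open import Data.Nat using (ℕ; zero; suc)
open import Data.Fin as Fin using (Fin)
open import Data.Integer as ℤ using (ℤ; 0ℤ; -_)
open import Data.Integer.Properties as ℤ using ()
open import Data.List as List using (List; []; _∷_; map; tabulate; filter)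
open import Data.List.Properties as List using ()
open import Data.List.Membership.Propositional using (_∈_)
open import Data.List.Membership.Propositional.Properties using (∈-map⁺; ∈-map⁻)
open import Data.Vec as Vec using (Vec; []; _∷_; _∷ʳ_; reverse)
open import Data.Vec.Properties as Vec using (reverse-∷; reverse-involutive; map-reverse)
open import Data.Fin.Permutation using (permutation)
open import Data.Product using (_×_; _,_; proj₂)
open import Data.Empty using (⊥-elim)
open import Function using (_∘_)
open import Relation.Nullary using (Dec; yes; no)
open import Relation.Binary.PropositionalEquality
  using (_≡_; _≢_; refl; sym; cong; cong₂; subst; subst₂; module ≡-Reasoning)
open import Algebra.Bundles using (CommutativeSemiring)
import Relation.Binary.PropositionalEquality as ≡

private
  variable
    k m n : ℕ

-- Only the heights reached after a step are required to be ≥ 0, not h itself.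
ExcursionFromTo : ℤ → Vec ℤ n → ℤ → Set
ExcursionFromTo h []      e = h ≡ e
ExcursionFromTo h (a ∷ v) e = 0ℤ ℤ.≤ h ℤ.+ a × ExcursionFromTo (h ℤ.+ a) v e

excursionFrom⇒excursionFromTo : ∀ h (v : Vec ℤ n) → ExcursionFrom h v → ExcursionFromTo h v 0ℤ
excursionFrom⇒excursionFromTo h []      h≡0        = h≡0
excursionFrom⇒excursionFromTo h (a ∷ v) (0≤h+a , e) = 0≤h+a , excursionFrom⇒excursionFromTo (h ℤ.+ a) v e

excursionFromTo⇒excursionFrom : ∀ h (v : Vec ℤ n) → ExcursionFromTo h v 0ℤ → ExcursionFrom h v
excursionFromTo⇒excursionFrom h []      h≡0        = h≡0
excursionFromTo⇒excursionFrom h (a ∷ v) (0≤h+a , e) = 0≤h+a , excursionFromTo⇒excursionFrom (h ℤ.+ a) v e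

ExcursionFromTo-∷ʳ : ∀ {h e} (v : Vec ℤ n) a →
                     ExcursionFromTo h v e → 0ℤ ℤ.≤ e ℤ.+ a → ExcursionFromTo h (v ∷ʳ a) (e ℤ.+ a)
ExcursionFromTo-∷ʳ []      a refl      0≤e+a = 0≤e+a , refl
ExcursionFromTo-∷ʳ (b ∷ v) a (0≤h+b , e) 0≤e+a = 0≤h+b , ExcursionFromTo-∷ʳ v a e 0≤e+a

+-neg-cancelʳ : ∀ h a → h ℤ.+ a ℤ.+ - a ≡ h
+-neg-cancelʳ h a = begin
  h ℤ.+ a ℤ.+ - a     ≡⟨ ℤ.+-assoc h a (- a) ⟩
  h ℤ.+ (a ℤ.+ - a)   ≡⟨ cong (ℤ._+_ h) (ℤ.+-inverseʳ a) ⟩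
  h ℤ.+ 0ℤ            ≡⟨ ℤ.+-identityʳ h ⟩
  h                   ∎
  where open ≡-Reasoning

-- The starting height must be ≥ 0, since it becomes the last position.
ExcursionFromTo-reverse : ∀ {h e} (v : Vec ℤ n) → 0ℤ ℤ.≤ h →
                          ExcursionFromTo h v e → ExcursionFromTo e (reverse (Vec.map -_ v)) h
ExcursionFromTo-reverse []      0≤h h≡e = sym h≡e
ExcursionFromTo-reverse {h = h} (a ∷ v) 0≤h (0≤h+a , e) =
  subst₂ (ExcursionFromTo _) (sym (reverse-∷ (- a) (Vec.map -_ v))) (+-neg-cancelʳ h a)
    (ExcursionFromTo-∷ʳ (reverse (Vec.map -_ v)) (- a)
      (ExcursionFromTo-reverse v 0≤h+a e)
      (subst (0ℤ ℤ.≤_) (sym (+-neg-cancelʳ h a)) 0≤h))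

excursion-reverse-neg : (v : Vec ℤ n) → Excursion v → Excursion (reverse (Vec.map -_ v))
excursion-reverse-neg v e =
  excursionFromTo⇒excursionFrom 0ℤ _
    (ExcursionFromTo-reverse v ℤ.≤-refl (excursionFrom⇒excursionFromTo 0ℤ v e))

module _ {steps : Fin k → NStep} where

  Compatible-∷ʳ : ∀ {w : NWalk k n} {v i a} →
                  Compatible steps w v → a ∈ steps i → Compatible steps (w ∷ʳ i) (v ∷ʳ a)
  Compatible-∷ʳ []        a∈ = a∈ ∷ []
  Compatible-∷ʳ (b∈ ∷ c) a∈ = b∈ ∷ Compatible-∷ʳ c a∈

  Compatible-reverse : ∀ {w : NWalk k n} {v} →
                       Compatible steps w v → Compatible steps (reverse w) (reverse v)
  Compatible-reverse []                              = []
  Compatible-reverse (_∷_ {i = i} {a} {w} {v} a∈ c) =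
    subst₂ (Compatible steps) (sym (reverse-∷ i w)) (sym (reverse-∷ a v))
      (Compatible-∷ʳ (Compatible-reverse c) a∈)

  Compatible-map : (π : Fin k → Fin k) (f : ℤ → ℤ) →
                   (∀ {i a} → a ∈ steps i → f a ∈ steps (π i)) →
                   ∀ {w : NWalk k n} {v} →
                   Compatible steps w v → Compatible steps (Vec.map π w) (Vec.map f v)
  Compatible-map π f π-resp []       = []
  Compatible-map π f π-resp (a∈ ∷ c) = π-resp a∈ ∷ Compatible-map π f π-resp c

SameSet-trans : ∀ {a b c} → SameSet a b → SameSet b c → SameSet a c
SameSet-trans (a⊆b , b⊆a) (b⊆c , c⊆b) = (λ x → b⊆c x ∘ a⊆b x) , (λ x → b⊆a x ∘ c⊆b x)

SameSet-reflexive : ∀ {a b} → a ≡ b → SameSet a b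
SameSet-reflexive refl = (λ _ x∈ → x∈) , (λ _ x∈ → x∈)

SameSet-map : (f : ℤ → ℤ) → ∀ {a b} → SameSet a b → SameSet (map f a) (map f b)
SameSet-map f (a⊆b , b⊆a) = map-⊆ a⊆b , map-⊆ b⊆a
  where
  map-⊆ : ∀ {a b} → (∀ x → x ∈ a → x ∈ b) → ∀ x → x ∈ map f a → x ∈ map f b
  map-⊆ a⊆b x x∈ with ∈-map⁻ f x∈
  ... | y , y∈a , refl = ∈-map⁺ f (a⊆b y y∈a)

map-neg-involutive : (a : List ℤ) → map -_ (map -_ a) ≡ a
map-neg-involutive []      = refl
map-neg-involutive (x ∷ a) = cong₂ _∷_ (ℤ.neg-involutive x) (map-neg-involutive a)

steps-injective⇒neg-involutive : (steps : Fin k → NStep) →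
                 (∀ i j → SameSet (steps i) (steps j) → i ≡ j) →
                 (neg : Fin k → Fin k) → (∀ i → SameSet (steps (neg i)) (map -_ (steps i))) →
                 ∀ i → neg (neg i) ≡ i
steps-injective⇒neg-involutive steps steps-injective neg neg-steps i =
  steps-injective (neg (neg i)) i
    (SameSet-trans (neg-steps (neg i))
      (SameSet-trans (SameSet-map -_ (neg-steps i))
        (SameSet-reflexive (map-neg-involutive (steps i)))))

reflect : (Fin k → Fin k) → NWalk k n → NWalk k n
reflect π w = reverse (Vec.map π w)

reflect-∷ : (π : Fin k → Fin k) (i : Fin k) (w : NWalk k n) →
            reflect π (i ∷ w) ≡ reflect π w ∷ʳ π i
reflect-∷ π i w = reverse-∷ (π i) (Vec.map π w)

reflect-involutive : (π : Fin k → Fin k) → (∀ i → π (π i) ≡ i) →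
                     (w : NWalk k n) → reflect π (reflect π w) ≡ w
reflect-involutive π π-involutive w = begin
  reverse (Vec.map π (reverse (Vec.map π w)))   ≡⟨ cong reverse (map-reverse π (Vec.map π w)) ⟩
  reverse (reverse (Vec.map π (Vec.map π w)))   ≡⟨ reverse-involutive _ ⟩
  Vec.map π (Vec.map π w)                       ≡⟨ Vec.map-∘ π π w ⟨
  Vec.map (π ∘ π) w                             ≡⟨ Vec.map-cong π-involutive w ⟩
  Vec.map (λ i → i) w                           ≡⟨ Vec.map-id w ⟩
  w                                             ∎
  where open ≡-Reasoning

module _ (steps : Fin k → NStep) (neg : Fin k → Fin k)
         (neg-steps : ∀ i → SameSet (steps (neg i)) (map -_ (steps i))) where

  neg-∈ : ∀ {i a} → a ∈ steps i → - a ∈ steps (neg i)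
  neg-∈ {i} {a} a∈ = proj₂ (neg-steps i) (- a) (∈-map⁺ -_ a∈)

  reflect-isNExcursion : (w : NWalk k n) → IsNExcursion steps w → IsNExcursion steps (reflect neg w)
  reflect-isNExcursion w (v , c , e) =
    reverse (Vec.map -_ v) , Compatible-reverse (Compatible-map neg -_ neg-∈ c) , excursion-reverse-neg v e

  reflect-isNExcursion⁻ : (∀ i → neg (neg i) ≡ i) →
                          (w : NWalk k n) → IsNExcursion steps (reflect neg w) → IsNExcursion steps w
  reflect-isNExcursion⁻ neg-neg w e =
    subst (IsNExcursion steps) (reflect-involutive neg neg-neg w)
      (reflect-isNExcursion (reflect neg w) e)

module Sums {c ℓ : Level} (R : CommutativeSemiring c ℓ) where
  open CommutativeSemiring R hiding (zero)
    renaming (refl to ≈-refl; sym to ≈-sym; trans to ≈-trans)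
  open import Algebra.Properties.CommutativeMonoid.Sum +-commutativeMonoid
    using (sum; ∑-comm; ∑-permute; sum-cong-≋)
  open import Relation.Binary.Reasoning.Setoid setoid

  Σ : List Carrier → Carrier
  Σ = sumR R

  Σ-++ : ∀ xs ys → Σ (xs List.++ ys) ≈ Σ xs + Σ ys
  Σ-++ []       ys = ≈-sym (+-identityˡ _)
  Σ-++ (x ∷ xs) ys = ≈-trans (+-congˡ (Σ-++ xs ys)) (≈-sym (+-assoc _ _ _))

  Σ-map-concatMap : ∀ {A B : Set} (f : B → Carrier) (g : A → List B) xs →
                    Σ (map f (List.concatMap g xs)) ≈ Σ (map (λ x → Σ (map f (g x))) xs)
  Σ-map-concatMap f g []       = ≈-refl
  Σ-map-concatMap f g (x ∷ xs) = begin
    Σ (map f (g x List.++ List.concatMap g xs))          ≡⟨ cong Σ (List.map-++ f (g x) _) ⟩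
    Σ (map f (g x) List.++ map f (List.concatMap g xs))  ≈⟨ Σ-++ (map f (g x)) _ ⟩
    Σ (map f (g x)) + Σ (map f (List.concatMap g xs))    ≈⟨ +-congˡ (Σ-map-concatMap f g xs) ⟩
    Σ (map (λ x → Σ (map f (g x))) (x ∷ xs))             ∎

  Σ-tabulate : (f : Fin m → Carrier) → Σ (tabulate f) ≡ sum f
  Σ-tabulate {zero}  f = ≡.refl
  Σ-tabulate {suc m} f = cong (f Fin.zero +_) (Σ-tabulate (f ∘ Fin.suc))

  Σ-map-cong : ∀ {A : Set} {f g : A → Carrier} → (∀ x → f x ≈ g x) →
               ∀ xs → Σ (map f xs) ≈ Σ (map g xs)
  Σ-map-cong f≈g []       = ≈-refl
  Σ-map-cong f≈g (x ∷ xs) = +-cong (f≈g x) (Σ-map-cong f≈g xs)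

  select : ∀ {A : Set} → Dec A → Carrier → Carrier
  select (yes _) x = x
  select (no _)  _ = 0#

  select-cong : ∀ {A B : Set} → (A → B) → (B → A) → (a? : Dec A) (b? : Dec B) →
                ∀ {x y} → x ≈ y → select a? x ≈ select b? y
  select-cong A→B B→A (yes _) (yes _) x≈y = x≈y
  select-cong A→B B→A (yes a) (no ¬b) _   = ⊥-elim (¬b (A→B a))
  select-cong A→B B→A (no ¬a) (yes b) _   = ⊥-elim (¬a (B→A b))
  select-cong A→B B→A (no _)  (no _)  _   = ≈-refl

  Σ-map-filter : ∀ {A : Set} {P : A → Set} (P? : ∀ x → Dec (P x)) (f : A → Carrier) xs →
                 Σ (map f (filter P? xs)) ≈ Σ (map (λ x → select (P? x) (f x)) xs)
  Σ-map-filter P? f []       = ≈-refl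
  Σ-map-filter P? f (x ∷ xs) with P? x
  ... | yes _ = +-congˡ (Σ-map-filter P? f xs)
  ... | no _  = ≈-trans (Σ-map-filter P? f xs) (≈-sym (+-identityˡ _))

  ∑Walks : (n : ℕ) → (NWalk k n → Carrier) → Carrier
  ∑Walks {k} n f = Σ (map f (allNWalks k n))

  ∑Walks-cong : ∀ {f g : NWalk k n → Carrier} → (∀ w → f w ≈ g w) → ∑Walks n f ≈ ∑Walks n g
  ∑Walks-cong {k} {n} f≈g = Σ-map-cong f≈g (allNWalks k n)

  ∑Walks-∷ : (f : NWalk k (suc n) → Carrier) → ∑Walks (suc n) f ≈ sum (λ i → ∑Walks n (f ∘ (i ∷_)))
  ∑Walks-∷ {k} {n} f = begin
    ∑Walks (suc n) f
      ≈⟨ Σ-map-concatMap f (λ i → map (i ∷_) (allNWalks k n)) (List.allFin k) ⟩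
    Σ (map (λ i → Σ (map f (map (i ∷_) (allNWalks k n)))) (List.allFin k))
      ≡⟨ cong Σ (List.map-cong (λ i → cong Σ (≡.sym (List.map-∘ (allNWalks k n)))) (List.allFin k)) ⟩
    Σ (map (λ i → ∑Walks n (f ∘ (i ∷_))) (List.allFin k))
      ≡⟨ cong Σ (List.map-tabulate (λ i → i) (λ i → ∑Walks n (f ∘ (i ∷_)))) ⟩
    Σ (tabulate (λ i → ∑Walks n (f ∘ (i ∷_))))
      ≡⟨ Σ-tabulate (λ i → ∑Walks n (f ∘ (i ∷_))) ⟩
    sum (λ i → ∑Walks n (f ∘ (i ∷_)))
      ∎

  ∑Walks-∷ʳ : ∀ n (f : NWalk k (suc n) → Carrier) →
              ∑Walks (suc n) f ≈ sum (λ i → ∑Walks n (λ w → f (w ∷ʳ i)))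
  ∑Walks-∷ʳ zero    f = ∑Walks-∷ f
  ∑Walks-∷ʳ (suc n) f = begin
    ∑Walks (suc (suc n)) f                                   ≈⟨ ∑Walks-∷ f ⟩
    sum (λ j → ∑Walks (suc n) (f ∘ (j ∷_)))                 ≈⟨ sum-cong-≋ (λ j → ∑Walks-∷ʳ n (f ∘ (j ∷_))) ⟩
    sum (λ j → sum (λ i → ∑Walks n (λ w → f (j ∷ (w ∷ʳ i))))) ≈⟨ ∑-comm (λ j i → ∑Walks n (λ w → f (j ∷ (w ∷ʳ i)))) ⟩
    sum (λ i → sum (λ j → ∑Walks n (λ w → f (j ∷ (w ∷ʳ i))))) ≈⟨ sum-cong-≋ (λ i → ∑Walks-∷ (λ w → f (w ∷ʳ i))) ⟨
    sum (λ i → ∑Walks (suc n) (λ w → f (w ∷ʳ i)))           ∎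

  ∑Walks-reflect : (π : Fin k → Fin k) → (∀ i → π (π i) ≡ i) →
                   ∀ n (f : NWalk k n → Carrier) → ∑Walks n (f ∘ reflect π) ≈ ∑Walks n f
  ∑Walks-reflect π π-involutive zero    f = ≈-refl
  ∑Walks-reflect π π-involutive (suc n) f = begin
    ∑Walks (suc n) (f ∘ reflect π)                   ≈⟨ ∑Walks-∷ (f ∘ reflect π) ⟩
    sum (λ i → ∑Walks n (f ∘ reflect π ∘ (i ∷_)))
      ≈⟨ sum-cong-≋ (λ i → ∑Walks-cong (λ w → reflexive (cong f (reflect-∷ π i w)))) ⟩
    sum (λ i → ∑Walks n (λ w → f (reflect π w ∷ʳ π i)))
      ≈⟨ sum-cong-≋ (λ i → ∑Walks-reflect π π-involutive n (λ u → f (u ∷ʳ π i))) ⟩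
    sum (λ i → ∑Walks n (λ u → f (u ∷ʳ π i)))
      ≈⟨ ∑-permute (λ i → ∑Walks n (λ u → f (u ∷ʳ i))) (permutation π π π-involutive π-involutive) ⟨
    sum (λ i → ∑Walks n (λ u → f (u ∷ʳ i)))          ≈⟨ ∑Walks-∷ʳ n f ⟨
    ∑Walks (suc n) f                                 ∎

  weight-∷ʳ : (p : Fin k → Carrier) (w : NWalk k n) (i : Fin k) →
              weight R p (w ∷ʳ i) ≈ weight R p w * p i
  weight-∷ʳ p []      i = ≈-trans (*-identityʳ _) (≈-sym (*-identityˡ _))
  weight-∷ʳ p (j ∷ w) i = ≈-trans (*-congˡ (weight-∷ʳ p w i)) (≈-sym (*-assoc _ _ _))

  weight-reflect : (p : Fin k → Carrier) (π : Fin k → Fin k) (w : NWalk k n) →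
                   weight R p (reflect π w) ≈ weight R (p ∘ π) w
  weight-reflect p π []      = ≈-refl
  weight-reflect p π (i ∷ w) = begin
    weight R p (reflect π (i ∷ w))      ≡⟨ cong (weight R p) (reflect-∷ π i w) ⟩
    weight R p (reflect π w ∷ʳ π i)     ≈⟨ weight-∷ʳ p (reflect π w) (π i) ⟩
    weight R p (reflect π w) * p (π i)  ≈⟨ *-congʳ (weight-reflect p π w) ⟩
    weight R (p ∘ π) w * p (π i)        ≈⟨ *-comm _ _ ⟩
    weight R (p ∘ π) (i ∷ w)            ∎

theorem5p3 : {c ℓ : Level} (R : CommutativeSemiring c ℓ)
    (k : ℕ) (steps : Fin k → NStep)
    → (∀ i → steps i ≢ [])
    → (∀ i j → SameSet (steps i) (steps j) → i ≡ j)
    → (neg : Fin k → Fin k)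
    → (∀ i → SameSet (steps (neg i)) (map -_ (steps i)))
    → (p : Fin k → CommutativeSemiring.Carrier R)
    → (n : ℕ)
    → CommutativeSemiring._≈_ R (D⁺-coeff R steps p n) (D⁺-coeff R steps (p ∘ neg) n)
theorem5p3 R k steps _ steps-injective neg neg-steps p n = begin
  D⁺-coeff R steps p n
    ≈⟨ Σ-map-filter E? (weight R p) (allNWalks k n) ⟩
  ∑Walks n (excursionWeight p)
    ≈⟨ ∑Walks-reflect neg neg-neg n (excursionWeight p) ⟨
  ∑Walks n (excursionWeight p ∘ reflect neg)
    ≈⟨ ∑Walks-cong excursionWeight-reflect ⟩
  ∑Walks n (excursionWeight (p ∘ neg))
    ≈⟨ Σ-map-filter E? (weight R (p ∘ neg)) (allNWalks k n) ⟨
  D⁺-coeff R steps (p ∘ neg) n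
    ∎
  where
  open CommutativeSemiring R using (Carrier; _≈_; setoid)
  open Sums R
  open import Relation.Binary.Reasoning.Setoid setoid

  E? : (w : NWalk k n) → Dec (IsNExcursion steps w)
  E? = isNExcursion? steps

  excursionWeight : (Fin k → Carrier) → NWalk k n → Carrier
  excursionWeight q w = select (E? w) (weight R q w)

  neg-neg : ∀ i → neg (neg i) ≡ i
  neg-neg = steps-injective⇒neg-involutive steps steps-injective neg neg-steps

  excursionWeight-reflect : ∀ w → excursionWeight p (reflect neg w) ≈ excursionWeight (p ∘ neg) w
  excursionWeight-reflect w = select-cong (reflect-isNExcursion⁻ steps neg neg-steps neg-neg w)
                               (reflect-isNExcursion steps neg neg-steps w)
                               (E? (reflect neg w)) (E? w) (weight-reflect p neg w)
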